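{- Let $k\ge 2$ and consider the graph $MB_k$ with distinguished vertices $s,t$ (and, when $k\ge 3$, $s',t'$). Then $b(s,MB_k)=b(t,MB_k)=k+1$, and for $k\ge 3$ also $b(s',MB_k)=b(t',MB_k)=k+1$.
   Context: Broadcasting in a connected graph $G$: initially only an originator vertex $v$ holds a message; in each discrete time unit, every vertex holding the message may send it to at most one uninformed neighbor. $b(v,G)$ denotes the minimum number of time units needed until all vertices are informed, over all such schemes. The graphs $MB_k$ are defined recursively: $MB_2$ is the path $s-a-b-t$ on four vertices. For $k\ge 3$, take two disjoint copies $C_1,C_2$ of $MB_{k-1}$ with distinguished vertices $s_1,t_1$ in $C_1$ and $s_2,t_2$ in $C_2$, add the edges $\{s_1,s_2\}$ and $\{t_1,t_2\}$, and set $s=s_2$, $t=t_1$, $s'=s_1$, $t'=t_2$. $MB_k$ has $2^k$ vertices. -}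

module Defs where

open import Data.Nat using (ℕ; zero; suc; _≤_; _+_)
open import Data.Fin using (Fin; zero; suc)
open import Data.Sum using (_⊎_; inj₁; inj₂)
open import Data.Product using (_×_; _,_; proj₁; proj₂; ∃; Σ-syntax)
open import Data.List using (List; []; _∷_; map; length)
open import Data.List.Relation.Unary.All using (All)
open import Data.List.Relation.Unary.Any using (Any)
open import Data.List.Relation.Unary.Unique.Propositional using (Unique)
open import Data.Unit using (⊤)
open import Relation.Nullary using (¬_)
open import Relation.Binary.PropositionalEquality using (_≡_)

record Graph : Set₁ where
  field
    V    : Set
    Adj  : V → V → Set
    sym  : ∀ {x y} → Adj x y → Adj y x

open Graph public

-- A round is a list of calls (sender , receiver).

module _ (G : Graph) where

  Round : Set
  Round = List (V G × V G)

  step : (V G → Set) → Round → V G → Set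
  step I R w = I w ⊎ Any (λ c → proj₂ c ≡ w) R

  ValidRound : (V G → Set) → Round → Set
  ValidRound I R =
    All (λ c → I (proj₁ c) × ¬ I (proj₂ c) × Adj G (proj₁ c) (proj₂ c)) R
    × Unique (map proj₁ R)

  run : (V G → Set) → List Round → V G → Set
  run I []       = I
  run I (R ∷ Rs) = run (step I R) Rs

  Valid : (V G → Set) → List Round → Set
  Valid I []       = ⊤
  Valid I (R ∷ Rs) = ValidRound I R × Valid (step I R) Rs

  IsBroadcastScheme : V G → List Round → Set
  IsBroadcastScheme v Rs = Valid (_≡ v) Rs × (∀ w → run (_≡ v) Rs w)

  BroadcastTime : V G → ℕ → Set
  BroadcastTime v m =
    (Σ[ Rs ∈ List Round ] (IsBroadcastScheme v Rs × length Rs ≡ m))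
    × (∀ Rs → IsBroadcastScheme v Rs → m ≤ length Rs)

-- The graphs MB_k, indexed by n with k = n + 2.
-- MB_2 : the path s - a - b - t on Fin 4 (0 - 1 - 2 - 3).
-- MB_{k+1} : copy C₁ = inj₁, copy C₂ = inj₂.

MBV : ℕ → Set
MBV zero    = Fin 4
MBV (suc n) = MBV n ⊎ MBV n

mb-s : (n : ℕ) → MBV n
mb-s zero    = zero
mb-s (suc n) = inj₂ (mb-s n)

mb-t : (n : ℕ) → MBV n
mb-t zero    = suc (suc (suc zero))
mb-t (suc n) = inj₁ (mb-t n)

mb-s' : (n : ℕ) → MBV (suc n)
mb-s' n = inj₁ (mb-s n)

mb-t' : (n : ℕ) → MBV (suc n)
mb-t' n = inj₂ (mb-t n)

data PathEdge : Fin 4 → Fin 4 → Set where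
  e01 : PathEdge zero (suc zero)
  e12 : PathEdge (suc zero) (suc (suc zero))
  e23 : PathEdge (suc (suc zero)) (suc (suc (suc zero)))

data MBArc : (n : ℕ) → MBV n → MBV n → Set where
  base : ∀ {x y} → PathEdge x y → MBArc zero x y
  in₁  : ∀ {n x y} → MBArc n x y → MBArc (suc n) (inj₁ x) (inj₁ y)
  in₂  : ∀ {n x y} → MBArc n x y → MBArc (suc n) (inj₂ x) (inj₂ y)
  ss   : ∀ {n} → MBArc (suc n) (inj₁ (mb-s n)) (inj₂ (mb-s n))
  tt   : ∀ {n} → MBArc (suc n) (inj₁ (mb-t n)) (inj₂ (mb-t n))

MBAdj : (n : ℕ) → MBV n → MBV n → Set
MBAdj n x y = MBArc n x y ⊎ MBArc n y x

MBAdj-sym : ∀ {n x y} → MBAdj n x y → MBAdj n y x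
MBAdj-sym (inj₁ a) = inj₂ a
MBAdj-sym (inj₂ a) = inj₁ a

MB : ℕ → Graph
MB n = record { V = MBV n ; Adj = MBAdj n ; sym = MBAdj-sym }

-- Lower bound: let v have degree at most d in a graph with at least 2^(d+1) vertices.
-- After i rounds let L be the number of informed vertices and e the number of rounds
-- in which v stayed silent.  A silent round of v lets at most L - 1 vertices call, a
-- call of v uses up one of its at most d neighbours; this is captured by the
-- invariant  L + 2^e ≤ 2^i + 1  and  i ≤ e + d.  When everyone is informed after T
-- rounds, 2^(d+1) + 2^e ≤ 2^T + 1 and T ≤ e + d, which forces T ≥ d + 2.  The
-- distinguished vertices of MB_k have degree k - 1 and MB_k has 2^k vertices.
-- Upper bound: a distinguished vertex of MB_k first calls its twin in the other copy
-- of MB_(k-1), then both copies run a scheme for MB_(k-1) in parallel; on the path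
-- MB_2 broadcasting from an end takes 3 rounds.

module Submission where

open import Defs hiding (sym)
open import Data.Nat using (ℕ; zero; suc; _+_; _*_; _^_; _≤_; _<_; z≤n; s≤s)
open import Data.Nat.Properties
open import Data.Nat.Solver using (module +-*-Solver)
open import Data.Product as Product using (_×_; _,_; proj₁; proj₂; Σ-syntax)
open import Data.Sum as Sum using (inj₁; inj₂)
open import Data.Sum.Properties using (≡-dec; inj₁-injective; inj₂-injective)
open import Data.Fin as Fin using (zero; suc; #_)
open import Data.Unit using (tt)
open import Data.List using (List; []; _∷_; map; length; _++_; filter; allFin)
open import Data.List.Properties using (length-map; length-++; filter-notAll; map-++; map-∘)
open import Data.List.Relation.Unary.All as All using (All; []; _∷_)
open import Data.List.Relation.Unary.Any as Any using (Any; here; there; any?)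
import Data.List.Relation.Unary.Any.Properties as Anyₚ
import Data.List.Relation.Unary.All.Properties as Allₚ
open import Data.List.Relation.Unary.AllPairs using ([]; _∷_)
open import Data.List.Relation.Unary.Unique.Propositional using (Unique)
import Data.List.Relation.Unary.Unique.Propositional.Properties as Uniqueₚ
open import Data.List.Relation.Binary.Subset.Propositional using (_⊆_)
open import Data.List.Membership.Propositional using (_∈_; find)
open import Data.List.Membership.Propositional.Properties using (∈-filter⁺; ∈-map⁺; ∈-map⁻; ∈-++⁺ˡ; ∈-++⁺ʳ)
open import Function using (_∘_)
open import Relation.Nullary using (¬_; ¬?; yes; no; contradiction)
open import Relation.Unary using (_≐_) renaming (_⊆_ to _⊆ₚ_)
open import Relation.Binary.Definitions using (DecidableEquality)
open import Relation.Binary.PropositionalEquality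
  using (_≡_; _≢_; refl; sym; trans; cong; cong₂; subst; module ≡-Reasoning)

module ListCounting {A : Set} (_≟_ : DecidableEquality A) where

  without : A → List A → List A
  without x = filter (λ y → ¬? (x ≟ y))

  ∈-without : ∀ {x y ys} → y ∈ ys → x ≢ y → y ∈ without x ys
  ∈-without = ∈-filter⁺ _

  length-without-< : ∀ {x ys} → x ∈ ys → length (without x ys) < length ys
  length-without-< {x} {ys} x∈ys = filter-notAll _ ys (Any.map (λ x≡y x≢y → x≢y x≡y) x∈ys)

  Unique-⊆⇒length-≤ : ∀ {xs ys} → Unique xs → xs ⊆ ys → length xs ≤ length ys
  Unique-⊆⇒length-≤ {[]}     _              _     = z≤n
  Unique-⊆⇒length-≤ {x ∷ xs} (x∉xs ∷ uniq) xs⊆ys = ≤-trans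
    (s≤s (Unique-⊆⇒length-≤ uniq λ z∈xs → ∈-without (xs⊆ys (there z∈xs)) (All.lookup x∉xs z∈xs)))
    (length-without-< (xs⊆ys (here refl)))

module _ {A B : Set} where

  Unique-⊎ : ∀ {xs : List A} {ys : List B} → Unique xs → Unique ys → Unique (map inj₁ xs ++ map inj₂ ys)
  Unique-⊎ {xs} {ys} uxs uys =
    Uniqueₚ.++⁺ (Uniqueₚ.map⁺ inj₁-injective uxs) (Uniqueₚ.map⁺ inj₂-injective uys) disjoint
    where
    disjoint : ∀ {z} → ¬ (z ∈ map inj₁ xs × z ∈ map inj₂ ys)
    disjoint (z∈₁ , z∈₂) with ∈-map⁻ inj₁ z∈₁ | ∈-map⁻ inj₂ z∈₂
    ... | _ , _ , refl | _ , _ , ()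

  length-⊎ : ∀ (xs : List A) (ys : List B) → length (map inj₁ xs ++ map inj₂ ys) ≡ length xs + length ys
  length-⊎ xs ys = trans (length-++ (map inj₁ xs)) (cong₂ _+_ (length-map inj₁ xs) (length-map inj₂ ys))

^-cancelʳ-≤ : ∀ b {m n} → 1 < b → b ^ m ≤ b ^ n → m ≤ n
^-cancelʳ-≤ b@(suc _) {m} {n} 1<b bᵐ≤bⁿ with m ≤? n
... | yes m≤n = m≤n
... | no  m≰n = contradiction bᵐ≤bⁿ (<⇒≱ (^-monoʳ-< b 1<b (≰⇒> m≰n)))

^-cancelʳ-< : ∀ b {m n} → 1 < b → b ^ m < b ^ n → m < n
^-cancelʳ-< b@(suc _) {m} {n} 1<b bᵐ<bⁿ with m <? n
... | yes m<n = m<n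
... | no  m≮n = contradiction (^-monoʳ-≤ b (≮⇒≥ m≮n)) (<⇒≱ bᵐ<bⁿ)

module _ where
  open ≤-Reasoning
  open +-*-Solver using (solve; _:+_; _:*_; _:=_; con)

  doubled-bound : ∀ {x l E P} → l + E ≤ P + 1 → x + 1 ≤ 2 * (l + E) → x ≤ 2 * P + 1
  doubled-bound {x} {l} {E} {P} l+E≤P+1 x+1≤2[l+E] = +-cancelʳ-≤ 1 x (2 * P + 1) (begin
    x + 1         ≤⟨ x+1≤2[l+E] ⟩
    2 * (l + E)   ≤⟨ *-monoʳ-≤ 2 l+E≤P+1 ⟩
    2 * (P + 1)   ≡⟨ solve 1 (λ P → con 2 :* (P :+ con 1) := con 2 :* P :+ con 1 :+ con 1) refl P ⟩
    2 * P + 1 + 1 ∎)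

  idle-round-bound : ∀ {l r E P} → suc r ≤ l → l + E ≤ P + 1 → l + r + 2 * E ≤ 2 * P + 1
  idle-round-bound {l} {r} {E} {P} r<l l+E≤P+1 = doubled-bound {l = l} {E = E} l+E≤P+1 (begin
    l + r + 2 * E + 1   ≡⟨ solve 3 (λ l r E → l :+ r :+ con 2 :* E :+ con 1
                                         := l :+ (con 1 :+ r) :+ con 2 :* E) refl l r E ⟩
    l + suc r + 2 * E   ≤⟨ +-monoˡ-≤ (2 * E) (+-monoʳ-≤ l r<l) ⟩
    l + l + 2 * E       ≡⟨ solve 2 (λ l E → l :+ l :+ con 2 :* E := con 2 :* (l :+ E)) refl l E ⟩
    2 * (l + E)         ∎)

  call-round-bound : ∀ {l r E P} → r ≤ l → 1 ≤ E → l + E ≤ P + 1 → l + r + E ≤ 2 * P + 1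
  call-round-bound {l} {r} {E} {P} r≤l 1≤E l+E≤P+1 = doubled-bound {l = l} {E = E} l+E≤P+1 (begin
    l + r + E + 1   ≤⟨ +-monoʳ-≤ (l + r + E) 1≤E ⟩
    l + r + E + E   ≤⟨ +-monoˡ-≤ E (+-monoˡ-≤ E (+-monoʳ-≤ l r≤l)) ⟩
    l + l + E + E   ≡⟨ solve 2 (λ l E → l :+ l :+ E :+ E := con 2 :* (l :+ E)) refl l E ⟩
    2 * (l + E)     ∎)

  rounds-lower-bound : ∀ {d T e l u} → 2 ^ suc d ≤ l → l + 2 ^ e ≤ 2 ^ T + 1 → T + u ≤ e + d → 2 + d ≤ T
  rounds-lower-bound {d} {T} {e} {l} {u} many size calls = ^-cancelʳ-< 2 1<2 (+-cancelʳ-≤ 1 _ _ (begin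
      suc (2 ^ suc d) + 1 ≡⟨ +-suc (2 ^ suc d) 1 ⟨
      2 ^ suc d + 2       ≤⟨ +-monoʳ-≤ (2 ^ suc d) (^-monoʳ-≤ 2 1≤e) ⟩
      2 ^ suc d + 2 ^ e   ≤⟨ full ⟩
      2 ^ T + 1           ∎))
    where
    1<2 : 1 < 2
    1<2 = s≤s (s≤s z≤n)
    full : 2 ^ suc d + 2 ^ e ≤ 2 ^ T + 1
    full = ≤-trans (+-monoˡ-≤ (2 ^ e) many) size
    d<T : suc d ≤ T
    d<T = ^-cancelʳ-≤ 2 1<2 (+-cancelʳ-≤ 1 _ _ (≤-trans (+-monoʳ-≤ (2 ^ suc d) (m^n>0 2 e)) full))
    1≤e : 1 ≤ e
    1≤e = +-cancelʳ-≤ d 1 e (≤-trans d<T (≤-trans (m≤m+n T u) calls))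

record DegreeAtMost (G : Graph) (v : V G) (d : ℕ) : Set where
  field
    neighbours          : List (V G)
    length-neighbours   : length neighbours ≡ d
    neighbours-complete : ∀ {w} → Adj G v w → w ∈ neighbours

Scheme : (G : Graph) → V G → ℕ → Set
Scheme G v m = Σ[ Rs ∈ List (Round G) ] (IsBroadcastScheme G v Rs × length Rs ≡ m)

single-call : ∀ G {I x y} → I x → ¬ I y → Adj G x y → ValidRound G I ((x , y) ∷ [])
single-call _ Ix ¬Iy adj = ((Ix , ¬Iy , adj) ∷ []) , [] ∷ []

Received : {A : Set} → List (A × A) → A → Set
Received R w = Any (λ c → proj₂ c ≡ w) R

module DegreeLowerBound (G : Graph) (_≟_ : DecidableEquality (V G))
                        {v : V G} {d : ℕ} (deg : DegreeAtMost G v d) where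
  open ListCounting _≟_
  open DegreeAtMost deg

  record Progress (I : V G → Set) (i : ℕ) : Set where
    field
      originator-informed : I v
      informed            : List (V G)
      informed-complete   : I ⊆ₚ (_∈ informed)
      pending             : List (V G)
      pending-complete    : ∀ {w} → Adj G v w → ¬ I w → w ∈ pending
      idle                : ℕ
      pending-bound       : i + length pending ≤ idle + d
      informed-bound      : length informed + 2 ^ idle ≤ 2 ^ i + 1

  module _ {I : V G → Set} {R : Round G} (valid : ValidRound G I R) {L : List (V G)}
           (I⊆L : I ⊆ₚ (_∈ L)) where

    senders-informed : map proj₁ R ⊆ L
    senders-informed s∈ with ∈-map⁻ proj₁ s∈
    ... | c , c∈R , refl = I⊆L (proj₁ (All.lookup (proj₁ valid) c∈R))

    senders-≤ : length R ≤ length L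
    senders-≤ = subst (_≤ length L) (length-map proj₁ R)
      (Unique-⊆⇒length-≤ (proj₂ valid) senders-informed)

    senders-< : I v → ¬ Any (λ c → proj₁ c ≡ v) R → suc (length R) ≤ length L
    senders-< Iv v-silent = subst (λ n → suc n ≤ length L) (length-map proj₁ R)
      (Unique-⊆⇒length-≤ (v∉senders ∷ proj₂ valid)
        λ { (here refl) → I⊆L Iv ; (there s∈) → senders-informed s∈ })
      where
      v∉senders : All (v ≢_) (map proj₁ R)
      v∉senders = Allₚ.map⁺ (All.map (λ s≢v v≡s → s≢v (sym v≡s)) (Allₚ.¬Any⇒All¬ R v-silent))

    step-informed : step G I R ⊆ₚ (_∈ L ++ map proj₂ R)
    step-informed (inj₁ Iw) = ∈-++⁺ˡ (I⊆L Iw)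
    step-informed (inj₂ w∈R) = ∈-++⁺ʳ L (Anyₚ.map⁺ (Any.map sym w∈R))

    length-step-informed : length (L ++ map proj₂ R) ≡ length L + length R
    length-step-informed = trans (length-++ L) (cong (length L +_) (length-map proj₂ R))

  progress-idle : ∀ {I i R} → Progress I i → ValidRound G I R → ¬ Any (λ c → proj₁ c ≡ v) R →
                  Progress (step G I R) (suc i)
  progress-idle {I} {i} {R} p valid v-silent = record
    { originator-informed = inj₁ originator-informed
    ; informed            = informed ++ map proj₂ R
    ; informed-complete   = step-informed valid informed-complete
    ; pending             = pending
    ; pending-complete    = λ adj ¬Iw → pending-complete adj (¬Iw ∘ inj₁)
    ; idle                = suc idle
    ; pending-bound       = s≤s pending-bound
    ; informed-bound      = subst (λ n → n + 2 ^ suc idle ≤ 2 ^ suc i + 1)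
        (sym (length-step-informed valid informed-complete))
        (idle-round-bound (senders-< valid informed-complete originator-informed v-silent) informed-bound)
    }
    where open Progress p

  progress-call : ∀ {I i R c} → Progress I i → ValidRound G I R → c ∈ R → proj₁ c ≡ v →
                  Progress (step G I R) (suc i)
  progress-call {I} {i} {R} {c} p valid c∈R refl = record
    { originator-informed = inj₁ originator-informed
    ; informed            = informed ++ map proj₂ R
    ; informed-complete   = step-informed valid informed-complete
    ; pending             = without (proj₂ c) pending
    ; pending-complete    = λ adj ¬Sw → ∈-without (pending-complete adj (¬Sw ∘ inj₁))
                              λ { refl → ¬Sw (inj₂ (Any.map (λ c≡ → cong proj₂ (sym c≡)) c∈R)) }
    ; idle                = idle
    ; pending-bound       = begin
        suc i + length (without (proj₂ c) pending) ≡⟨ +-suc i _ ⟨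
        i + suc (length (without (proj₂ c) pending)) ≤⟨ +-monoʳ-≤ i (length-without-< callee-pending) ⟩
        i + length pending                           ≤⟨ pending-bound ⟩
        idle + d                                     ∎
    ; informed-bound      = subst (λ n → n + 2 ^ idle ≤ 2 ^ suc i + 1)
        (sym (length-step-informed valid informed-complete))
        (call-round-bound (senders-≤ valid informed-complete) (m^n>0 2 idle) informed-bound)
    }
    where
    open Progress p
    open ≤-Reasoning
    callee-pending : proj₂ c ∈ pending
    callee-pending = let (_ , ¬Iw , adj) = All.lookup (proj₁ valid) c∈R in pending-complete adj ¬Iw

  progress-step : ∀ {I i R} → Progress I i → ValidRound G I R → Progress (step G I R) (suc i)
  progress-step {R = R} p valid with any? (λ c → proj₁ c ≟ v) R
  ... | no  v-silent = progress-idle p valid v-silent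
  ... | yes v-calls  = let (_ , c∈R , c-from-v) = find v-calls in progress-call p valid c∈R c-from-v

  progress-run : ∀ {I i} Rs → Progress I i → Valid G I Rs → Progress (run G I Rs) (i + length Rs)
  progress-run {I} {i} []       p _               = subst (Progress I) (sym (+-identityʳ i)) p
  progress-run {I} {i} (R ∷ Rs) p (valid , valids) =
    subst (Progress (run G (step G I R) Rs)) (sym (+-suc i (length Rs)))
          (progress-run Rs (progress-step p valid) valids)

  progress-start : Progress (_≡ v) 0
  progress-start = record
    { originator-informed = refl
    ; informed            = v ∷ []
    ; informed-complete   = λ { refl → here refl }
    ; pending             = neighbours
    ; pending-complete    = λ adj _ → neighbours-complete adj
    ; idle                = 0
    ; pending-bound       = ≤-reflexive length-neighbours
    ; informed-bound      = ≤-refl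
    }

  broadcast-lower-bound : ∀ {vs} → Unique vs → 2 ^ suc d ≤ length vs →
                          ∀ {Rs} → IsBroadcastScheme G v Rs → 2 + d ≤ length Rs
  broadcast-lower-bound {vs} uniq many {Rs} (valid , complete) =
    rounds-lower-bound (≤-trans many (Unique-⊆⇒length-≤ uniq λ {w} _ → informed-complete (complete w)))
                       informed-bound pending-bound
    where open Progress (progress-run Rs progress-start valid)

mb-≟ : ∀ n → DecidableEquality (MBV n)
mb-≟ zero    = Fin._≟_
mb-≟ (suc n) = ≡-dec (mb-≟ n) (mb-≟ n)

mb-vertices : ∀ n → List (MBV n)
mb-vertices zero    = allFin 4
mb-vertices (suc n) = map inj₁ (mb-vertices n) ++ map inj₂ (mb-vertices n)

mb-vertices-unique : ∀ n → Unique (mb-vertices n)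
mb-vertices-unique zero    = Uniqueₚ.allFin⁺ 4
mb-vertices-unique (suc n) = Unique-⊎ (mb-vertices-unique n) (mb-vertices-unique n)

length-mb-vertices : ∀ n → length (mb-vertices n) ≡ 2 ^ suc (suc n)
length-mb-vertices zero    = refl
length-mb-vertices (suc n) = begin
  length (mb-vertices (suc n))                 ≡⟨ length-⊎ (mb-vertices n) (mb-vertices n) ⟩
  length (mb-vertices n) + length (mb-vertices n) ≡⟨ cong (λ m → m + m) (length-mb-vertices n) ⟩
  2 ^ suc (suc n) + 2 ^ suc (suc n)            ≡⟨ cong (2 ^ suc (suc n) +_) (+-identityʳ _) ⟨
  2 ^ suc (suc (suc n))                        ∎
  where open ≡-Reasoning

module _ {n : ℕ} {c : MBV n} {d : ℕ} (deg : DegreeAtMost (MB n) c d) where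
  open DegreeAtMost deg

  degree-inj₁ : DegreeAtMost (MB (suc n)) (inj₁ c) (suc d)
  degree-inj₁ = record
    { neighbours          = inj₂ c ∷ map inj₁ neighbours
    ; length-neighbours   = cong suc (trans (length-map inj₁ neighbours) length-neighbours)
    ; neighbours-complete = λ
        { (inj₁ (in₁ arc)) → there (∈-map⁺ inj₁ (neighbours-complete (inj₁ arc)))
        ; (inj₂ (in₁ arc)) → there (∈-map⁺ inj₁ (neighbours-complete (inj₂ arc)))
        ; (inj₁ ss)        → here refl
        ; (inj₁ tt)        → here refl
        }
    }

  degree-inj₂ : DegreeAtMost (MB (suc n)) (inj₂ c) (suc d)
  degree-inj₂ = record
    { neighbours          = inj₁ c ∷ map inj₂ neighbours
    ; length-neighbours   = cong suc (trans (length-map inj₂ neighbours) length-neighbours)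
    ; neighbours-complete = λ
        { (inj₁ (in₂ arc)) → there (∈-map⁺ inj₂ (neighbours-complete (inj₁ arc)))
        ; (inj₂ (in₂ arc)) → there (∈-map⁺ inj₂ (neighbours-complete (inj₂ arc)))
        ; (inj₂ ss)        → here refl
        ; (inj₂ tt)        → here refl
        }
    }

degree-s : ∀ n → DegreeAtMost (MB n) (mb-s n) (suc n)
degree-s zero    = record
  { neighbours          = suc zero ∷ []
  ; length-neighbours   = refl
  ; neighbours-complete = λ { (inj₁ (base e01)) → here refl ; (inj₂ (base ())) }
  }
degree-s (suc n) = degree-inj₂ (degree-s n)

degree-t : ∀ n → DegreeAtMost (MB n) (mb-t n) (suc n)
degree-t zero    = record
  { neighbours          = suc (suc zero) ∷ []
  ; length-neighbours   = refl
  ; neighbours-complete = λ { (inj₁ (base ())) ; (inj₂ (base e23)) → here refl }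
  }
degree-t (suc n) = degree-inj₁ (degree-t n)

mb-lower-bound : ∀ {n c} → DegreeAtMost (MB n) c (suc n) →
                 ∀ Rs → IsBroadcastScheme (MB n) c Rs → n + 3 ≤ length Rs
mb-lower-bound {n} deg Rs scheme = subst (_≤ length Rs) (+-comm 3 n)
  (DegreeLowerBound.broadcast-lower-bound (MB n) (mb-≟ n) deg (mb-vertices-unique n)
    (≤-reflexive (sym (length-mb-vertices n))) scheme)

module Doubling {n : ℕ} where

  copy : (MBV n → MBV (suc n)) → MBV n × MBV n → MBV (suc n) × MBV (suc n)
  copy ι = Product.map ι ι

  double : Round (MB n) → Round (MB (suc n))
  double R = map (copy inj₁) R ++ map (copy inj₂) R

  Doubled : (MBV n → Set) → MBV (suc n) → Set
  Doubled I (inj₁ a) = I a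
  Doubled I (inj₂ a) = I a

  received-double : (R : Round (MB n)) → Received (double R) ≐ Doubled (Received R)
  received-double R = to , from
    where
    to : Received (double R) ⊆ₚ Doubled (Received R)
    to {inj₁ a} r with Anyₚ.++⁻ (map (copy inj₁) R) r
    ... | inj₁ r₁ = Any.map inj₁-injective (Anyₚ.map⁻ r₁)
    ... | inj₂ r₂ = contradiction (proj₂ (Any.satisfied (Anyₚ.map⁻ r₂))) λ ()
    to {inj₂ a} r with Anyₚ.++⁻ (map (copy inj₁) R) r
    ... | inj₁ r₁ = contradiction (proj₂ (Any.satisfied (Anyₚ.map⁻ r₁))) λ ()
    ... | inj₂ r₂ = Any.map inj₂-injective (Anyₚ.map⁻ r₂)
    from : Doubled (Received R) ⊆ₚ Received (double R)
    from {inj₁ a} r = Anyₚ.++⁺ˡ (Anyₚ.map⁺ (Any.map (cong inj₁) r))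
    from {inj₂ a} r = Anyₚ.++⁺ʳ (map (copy inj₁) R) (Anyₚ.map⁺ (Any.map (cong inj₂) r))

  senders-double : (R : Round (MB n)) →
                   map proj₁ (double R) ≡ map inj₁ (map proj₁ R) ++ map inj₂ (map proj₁ R)
  senders-double R = trans (map-++ proj₁ (map (copy inj₁) R) _)
    (cong₂ _++_ (trans (sym (map-∘ R)) (map-∘ R)) (trans (sym (map-∘ R)) (map-∘ R)))

  module _ {I : MBV n → Set} {J : MBV (suc n) → Set} (J≐I : J ≐ Doubled I) where
    private
      J⊆I : J ⊆ₚ Doubled I
      J⊆I = proj₁ J≐I
      I⊆J : Doubled I ⊆ₚ J
      I⊆J = proj₂ J≐I

    step-double : ∀ R → step (MB (suc n)) J (double R) ≐ Doubled (step (MB n) I R)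
    step-double R = to , from
      where
      to : step (MB (suc n)) J (double R) ⊆ₚ Doubled (step (MB n) I R)
      to {inj₁ _} = Sum.map J⊆I (proj₁ (received-double R))
      to {inj₂ _} = Sum.map J⊆I (proj₁ (received-double R))
      from : Doubled (step (MB n) I R) ⊆ₚ step (MB (suc n)) J (double R)
      from {inj₁ _} = Sum.map I⊆J (proj₂ (received-double R))
      from {inj₂ _} = Sum.map I⊆J (proj₂ (received-double R))

    validRound-double : ∀ {R} → ValidRound (MB n) I R → ValidRound (MB (suc n)) J (double R)
    validRound-double {R} (calls , uniq) =
      Allₚ.++⁺ (Allₚ.map⁺ (All.map (λ (Ix , ¬Iy , adj) → I⊆J Ix , ¬Iy ∘ J⊆I , Sum.map in₁ in₁ adj) calls))
               (Allₚ.map⁺ (All.map (λ (Ix , ¬Iy , adj) → I⊆J Ix , ¬Iy ∘ J⊆I , Sum.map in₂ in₂ adj) calls)) ,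
      subst Unique (sym (senders-double R)) (Unique-⊎ uniq uniq)

  valid-double : ∀ {I J} Rs → J ≐ Doubled I → Valid (MB n) I Rs →
                 Valid (MB (suc n)) J (map double Rs)
                 × run (MB (suc n)) J (map double Rs) ≐ Doubled (run (MB n) I Rs)
  valid-double []       J≐I _                = tt , J≐I
  valid-double (R ∷ Rs) J≐I (valid , valids) =
    let (valids′ , run≐) = valid-double Rs (step-double J≐I R) valids
    in (validRound-double J≐I valid , valids′) , run≐

  scheme-after-call : ∀ {c m x y} → Adj (MB (suc n)) x y → y ≢ x →
                      step (MB (suc n)) (_≡ x) ((x , y) ∷ []) ≐ Doubled (_≡ c) →
                      Scheme (MB n) c m → Scheme (MB (suc n)) x (suc m)
  scheme-after-call {c} {x = x} {y} adj y≢x first≐ (Rs , (valid , complete) , length-Rs) =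
    ((x , y) ∷ []) ∷ map double Rs ,
    ((first-call , proj₁ doubled) , λ w → proj₂ (proj₂ doubled) (everyone w)) ,
    cong suc (trans (length-map double Rs) length-Rs)
    where
    first-call : ValidRound (MB (suc n)) (_≡ x) ((x , y) ∷ [])
    first-call = single-call (MB (suc n)) refl y≢x adj
    doubled : Valid (MB (suc n)) (step (MB (suc n)) (_≡ x) ((x , y) ∷ [])) (map double Rs)
              × run (MB (suc n)) (step (MB (suc n)) (_≡ x) ((x , y) ∷ [])) (map double Rs)
                ≐ Doubled (run (MB n) (_≡ c) Rs)
    doubled = valid-double Rs first≐ valid
    everyone : ∀ w → Doubled (run (MB n) (_≡ c) Rs) w
    everyone (inj₁ a) = complete a
    everyone (inj₂ a) = complete a

  scheme-double : ∀ {c m} → MBArc (suc n) (inj₁ c) (inj₂ c) → Scheme (MB n) c m →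
                  Scheme (MB (suc n)) (inj₁ c) (suc m) × Scheme (MB (suc n)) (inj₂ c) (suc m)
  scheme-double {c} arc S =
    scheme-after-call (inj₁ arc) (λ ()) (to₁ , from₁) S ,
    scheme-after-call (inj₂ arc) (λ ()) (to₂ , from₂) S
    where
    to₁ : step (MB (suc n)) (_≡ inj₁ c) ((inj₁ c , inj₂ c) ∷ []) ⊆ₚ Doubled (_≡ c)
    to₁ {inj₁ _} (inj₁ refl)        = refl
    to₁ {inj₂ _} (inj₂ (here refl)) = refl
    to₁ {inj₁ _} (inj₂ (here ()))
    from₁ : Doubled (_≡ c) ⊆ₚ step (MB (suc n)) (_≡ inj₁ c) ((inj₁ c , inj₂ c) ∷ [])
    from₁ {inj₁ _} refl = inj₁ refl
    from₁ {inj₂ _} refl = inj₂ (here refl)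
    to₂ : step (MB (suc n)) (_≡ inj₂ c) ((inj₂ c , inj₁ c) ∷ []) ⊆ₚ Doubled (_≡ c)
    to₂ {inj₂ _} (inj₁ refl)        = refl
    to₂ {inj₁ _} (inj₂ (here refl)) = refl
    to₂ {inj₂ _} (inj₂ (here ()))
    from₂ : Doubled (_≡ c) ⊆ₚ step (MB (suc n)) (_≡ inj₂ c) ((inj₂ c , inj₁ c) ∷ [])
    from₂ {inj₂ _} refl = inj₁ refl
    from₂ {inj₁ _} refl = inj₂ (here refl)

path-scheme-s : Scheme (MB zero) (mb-s zero) 3
path-scheme-s = rounds , ((valid , complete) , refl)
  where
  rounds : List (Round (MB zero))
  rounds = ((# 0 , # 1) ∷ []) ∷ ((# 1 , # 2) ∷ []) ∷ ((# 2 , # 3) ∷ []) ∷ []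
  valid : Valid (MB zero) (_≡ # 0) rounds
  valid = single-call (MB zero) refl (λ ()) (inj₁ (base e01))
        , single-call (MB zero) (inj₂ (here refl)) (λ { (inj₁ ()) ; (inj₂ (here ())) }) (inj₁ (base e12))
        , single-call (MB zero) (inj₂ (here refl))
            (λ { (inj₁ (inj₁ ())) ; (inj₁ (inj₂ (here ()))) ; (inj₂ (here ())) }) (inj₁ (base e23))
        , tt
  complete : ∀ w → run (MB zero) (_≡ # 0) rounds w
  complete zero                   = inj₁ (inj₁ (inj₁ refl))
  complete (suc zero)             = inj₁ (inj₁ (inj₂ (here refl)))
  complete (suc (suc zero))       = inj₁ (inj₂ (here refl))
  complete (suc (suc (suc zero))) = inj₂ (here refl)

path-scheme-t : Scheme (MB zero) (mb-t zero) 3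
path-scheme-t = rounds , ((valid , complete) , refl)
  where
  rounds : List (Round (MB zero))
  rounds = ((# 3 , # 2) ∷ []) ∷ ((# 2 , # 1) ∷ []) ∷ ((# 1 , # 0) ∷ []) ∷ []
  valid : Valid (MB zero) (_≡ # 3) rounds
  valid = single-call (MB zero) refl (λ ()) (inj₂ (base e23))
        , single-call (MB zero) (inj₂ (here refl)) (λ { (inj₁ ()) ; (inj₂ (here ())) }) (inj₂ (base e12))
        , single-call (MB zero) (inj₂ (here refl))
            (λ { (inj₁ (inj₁ ())) ; (inj₁ (inj₂ (here ()))) ; (inj₂ (here ())) }) (inj₂ (base e01))
        , tt
  complete : ∀ w → run (MB zero) (_≡ # 3) rounds w
  complete zero                   = inj₂ (here refl)
  complete (suc zero)             = inj₁ (inj₂ (here refl))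
  complete (suc (suc zero))       = inj₁ (inj₁ (inj₂ (here refl)))
  complete (suc (suc (suc zero))) = inj₁ (inj₁ (inj₁ refl))

open Doubling using (scheme-double)

scheme-s : ∀ n → Scheme (MB n) (mb-s n) (n + 3)
scheme-s zero    = path-scheme-s
scheme-s (suc n) = proj₂ (scheme-double ss (scheme-s n))

scheme-t : ∀ n → Scheme (MB n) (mb-t n) (n + 3)
scheme-t zero    = path-scheme-t
scheme-t (suc n) = proj₁ (scheme-double tt (scheme-t n))

mb-broadcast-time : ∀ {n c} → Scheme (MB n) c (n + 3) → DegreeAtMost (MB n) c (suc n) →
                    BroadcastTime (MB n) c (n + 3)
mb-broadcast-time scheme deg = scheme , mb-lower-bound deg

lemma2 : ((n : ℕ) → BroadcastTime (MB n) (mb-s n) (n + 3)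
                    × BroadcastTime (MB n) (mb-t n) (n + 3))
         × ((n : ℕ) → BroadcastTime (MB (suc n)) (mb-s' n) (n + 4)
                    × BroadcastTime (MB (suc n)) (mb-t' n) (n + 4))
lemma2 =
  (λ n → mb-broadcast-time (scheme-s n) (degree-s n) , mb-broadcast-time (scheme-t n) (degree-t n)) ,
  (λ n → subst (BroadcastTime _ (mb-s' n)) (sym (+-suc n 3))
           (mb-broadcast-time (proj₁ (scheme-double ss (scheme-s n))) (degree-inj₁ (degree-s n))) ,
         subst (BroadcastTime _ (mb-t' n)) (sym (+-suc n 3))
           (mb-broadcast-time (proj₂ (scheme-double tt (scheme-t n))) (degree-inj₂ (degree-t n))))
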